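{- For every $n\ge2$, the interval $\Xi_n=\Lambda_{2n-1}\cup\Lambda_{2n}$ is a union of adjacent translates of $\Lambda_3,\Lambda_4,\Lambda_5$, and for all $n\ge0$ $$C(\Xi_{n+2})=\delta\big(h^n(b)\big),$$ where $h$ is the morphism on $\{a,b\}^*$ given by $h(a)=aab$, $h(b)=ab$, and $\delta:\{a,b\}^*\to\{3,4,5\}^*$ is the morphism $\delta(a)=54$, $\delta(b)=34$.
   Context: Lucas numbers: $L_0=2$, $L_1=1$, $L_n=L_{n-1}+L_{n-2}$. Lucas intervals (integer intervals): $\Lambda_{2n}=[L_{2n},L_{2n+1}]$, $\Lambda_{2n+1}=[L_{2n+1}+1,L_{2n+2}-1]$ for $n\ge0$; $\Xi_n=\Lambda_{2n-1}\cup\Lambda_{2n}=[L_{2n-1}+1,L_{2n+1}]$. For $n\ge6$, $\Lambda_n$ is the union of the three consecutive disjoint intervals $\Lambda_{n-2}+L_{n-1}$, $\Lambda_{n-3}+L_n$, $\Lambda_{n-2}+L_n$, where $A+x=\{a+x:a\in A\}$. The canonical splitting of $\Lambda_n$ ($n\ge3$) into translates of $\Lambda_3,\Lambda_4,\Lambda_5$ is: $\Lambda_n$ itself for $n\in\{3,4,5\}$; for $n\ge6$, the translates of the canonical splittings of $\Lambda_{n-2},\Lambda_{n-3},\Lambda_{n-2}$ to the three pieces above. $C(\Lambda_n)$ is the word over $\{3,4,5\}$ of the indices of the successive translates in the canonical splitting of $\Lambda_n$, and $C(\Xi_n)=C(\Lambda_{2n-1})C(\Lambda_{2n})$ (concatenation).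 -}

module Defs where

open import Data.Nat using (ℕ; zero; suc; _+_; _*_; _∸_)
open import Data.Nat.Properties using ()
open import Data.Bool using (Bool; true; false; if_then_else_)
open import Data.List using (List; []; _∷_; _++_; map; concatMap)
open import Data.Product using (_×_; _,_; proj₁)
open import Data.Sum using (_⊎_)
open import Relation.Binary.PropositionalEquality using (_≡_)

L : ℕ → ℕ
L zero = 2
L (suc zero) = 1
L (suc (suc n)) = L (suc n) + L n

even : ℕ → Bool
even zero = true
even (suc zero) = false
even (suc (suc n)) = even n

-- Lucas interval Λ_n = [lo n, hi n] (integer interval)
-- Λ_{2m}   = [L_{2m}, L_{2m+1}]
-- Λ_{2m+1} = [L_{2m+1}+1, L_{2m+2}-1]
lo : ℕ → ℕ
lo n = if even n then L n else suc (L n)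

hi : ℕ → ℕ
hi n = if even n then L (suc n) else L (suc n) ∸ 1

loΞ : ℕ → ℕ
loΞ n = suc (L (2 * n ∸ 1))

hiΞ : ℕ → ℕ
hiΞ n = L (suc (2 * n))

-- A translate Λ_k + x is represented by the pair (k , x).
Translate : Set
Translate = ℕ × ℕ

shift : ℕ → Translate → Translate
shift y (k , x) = (k , x + y)

-- Canonical splitting of Λ_n (n ≥ 3) into translates of Λ_3, Λ_4, Λ_5,
-- in increasing order.  (Values for n < 3 are irrelevant and set to [].)
split : ℕ → List Translate
split 0 = []
split 1 = []
split 2 = []
split 3 = (3 , 0) ∷ []
split 4 = (4 , 0) ∷ []
split 5 = (5 , 0) ∷ []
split (suc (suc (suc (suc (suc (suc k)))))) =
  map (shift (L (5 + k))) (split (suc (suc (suc (suc k))))) ++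
  map (shift (L (6 + k))) (split (suc (suc (suc k)))) ++
  map (shift (L (6 + k))) (split (suc (suc (suc (suc k)))))

splitΞ : ℕ → List Translate
splitΞ n = split (2 * n ∸ 1) ++ split (2 * n)

C : List Translate → List ℕ
C = map proj₁

CΞ : ℕ → List ℕ
CΞ n = C (splitΞ n)

Is345 : ℕ → Set
Is345 k = (k ≡ 3) ⊎ (k ≡ 4) ⊎ (k ≡ 5)

-- The empty list tiles [a,b]
-- only when it is empty, i.e. a = b + 1.
Tiles : ℕ → ℕ → List Translate → Set
Tiles a b [] = a ≡ suc b
Tiles a b ((k , x) ∷ ts) =
  Is345 k × (lo k + x ≡ a) × Tiles (suc (hi k + x)) b ts

data AB : Set where
  a b : AB

hL : AB → List AB
hL a = a ∷ a ∷ b ∷ []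
hL b = a ∷ b ∷ []

h : List AB → List AB
h = concatMap hL

h^ : ℕ → List AB → List AB
h^ zero w = w
h^ (suc n) w = h (h^ n w)

δL : AB → List ℕ
δL a = 5 ∷ 4 ∷ []
δL b = 3 ∷ 4 ∷ []

δ : List AB → List ℕ
δ = concatMap δL

-- With p(n) ∈ {0,1} the parity of n, Λ_n = [L_n + p(n), L_{n+1} − p(n)], so consecutive Lucas
-- intervals are adjacent, and the three translates in the splitting of Λ_{k+6} adjoin
-- and cover Λ_{k+6} by the Lucas recurrence alone; induction then tiles every Λ_n and
-- hence Ξ_n.  Since the splitting gives C(Λ_{k+6}) = C(Λ_{k+4}) C(Λ_{k+3}) C(Λ_{k+4}),
-- replacing δ(a) = 54 and δ(b) = 34 by C(Λ_{k+5}) C(Λ_{k+4}) and C(Λ_{k+3}) C(Λ_{k+4})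
-- turns one application of h into the shift k ↦ k + 2; starting from k = 0 this gives
-- δ(h^n(b)) = C(Λ_{2n+3}) C(Λ_{2n+4}) = C(Ξ_{n+2}).
module Submission where

open import Defs
open import Data.Nat using (ℕ; zero; suc; _+_; _*_; _∸_; _≤_; _<_; s≤s; z≤n)
open import Data.Nat.Properties
  using (+-comm; +-assoc; +-identityʳ; *-suc; *-distribˡ-+; m≤m+n; <-≤-trans; suc-injective)
open import Data.Nat.Tactic.RingSolver using (solve-∀)
open import Data.Bool using (if_then_else_)
open import Data.List using (List; []; _∷_; _++_; map; concatMap)
open import Data.List.Properties using (map-∘; map-++; ++-assoc; ++-identityʳ; concatMap-++; concatMap-cong)
open import Data.Product using (_×_; _,_; proj₁)
open import Data.Sum using (inj₁; inj₂)
open import Relation.Binary.PropositionalEquality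
  using (_≡_; refl; sym; trans; cong; cong₂; subst; subst₂; module ≡-Reasoning)

open ≡-Reasoning

Tiles-resp : ∀ {a a′ b b′} ts → a ≡ a′ → b ≡ b′ → Tiles a b ts → Tiles a′ b′ ts
Tiles-resp ts a≡a′ b≡b′ = subst₂ (λ x y → Tiles x y ts) a≡a′ b≡b′

Tiles-++ : ∀ {a m b} ts {us} → Tiles a m ts → Tiles (suc m) b us → Tiles a b (ts ++ us)
Tiles-++ []             refl                tiling = tiling
Tiles-++ ((k , x) ∷ ts) (k∈ , start , rest) tiling = k∈ , start , Tiles-++ ts rest tiling

Tiles-shift : ∀ y {a b} ts → Tiles a b ts → Tiles (a + y) (b + y) (map (shift y) ts)
Tiles-shift y []             a≡1+b = cong (_+ y) a≡1+b
Tiles-shift y ((k , x) ∷ ts) (k∈ , start , rest) =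
  k∈ ,
  trans (sym (+-assoc (lo k) x y)) (cong (_+ y) start) ,
  Tiles-resp (map (shift y) ts) (cong suc (+-assoc (hi k) x y)) refl (Tiles-shift y ts rest)

parity : ℕ → ℕ
parity zero          = 0
parity (suc zero)    = 1
parity (suc (suc n)) = parity n

parity-odd : ∀ m → parity (suc (2 * m)) ≡ 1
parity-odd zero    = refl
parity-odd (suc m) = trans (cong (λ j → parity (suc j)) (*-suc 2 m)) (parity-odd m)

0<L-suc : ∀ n → 0 < L (suc n)
0<L-suc zero    = s≤s z≤n
0<L-suc (suc n) = <-≤-trans (0<L-suc n) (m≤m+n _ _)

lo≡L+parity : ∀ n → lo n ≡ L n + parity n
lo≡L+parity n = go n (L n)
  where
  go : ∀ n m → (if even n then m else suc m) ≡ m + parity n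
  go zero          m = sym (+-identityʳ m)
  go (suc zero)    m = +-comm 1 m
  go (suc (suc n)) m = go n m

suc-hi≡lo-suc : ∀ n → suc (hi n) ≡ lo (suc n)
suc-hi≡lo-suc n = go n (0<L-suc n)
  where
  go : ∀ n {m} → 0 < m → suc (if even n then m else m ∸ 1) ≡ (if even (suc n) then m else suc m)
  go zero          _         = refl
  go (suc zero)    {suc m} _ = refl
  go (suc (suc n)) 0<m       = go n 0<m

split-step-tiles : ∀ k {ts us} →
  Tiles (lo (4 + k)) (hi (4 + k)) ts → Tiles (lo (3 + k)) (hi (3 + k)) us →
  Tiles (lo (6 + k)) (hi (6 + k))
    (map (shift (L (5 + k))) ts ++ map (shift (L (6 + k))) us ++ map (shift (L (6 + k))) ts)
split-step-tiles k {ts} {us} tiles-ts tiles-us =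
  Tiles-resp (map (shift (L (5 + k))) ts ++ _) (sym starts) ends
    (Tiles-++ (map (shift (L (5 + k))) ts) (Tiles-shift (L (5 + k)) ts tiles-ts)
      (Tiles-resp (map (shift (L (6 + k))) us ++ _) (sym gap₁) refl
        (Tiles-++ (map (shift (L (6 + k))) us) (Tiles-shift (L (6 + k)) us tiles-us)
          (Tiles-resp (map (shift (L (6 + k))) ts) (sym gap₂) refl
            (Tiles-shift (L (6 + k)) ts tiles-ts)))))
  where
  lucas₁ : ∀ u v e → ((v + u) + v) + e ≡ (v + e) + (v + u)
  lucas₁ = solve-∀
  lucas₂ : ∀ u v e → ((v + u) + e) + (v + u) ≡ (u + e) + ((v + u) + v)
  lucas₂ = solve-∀
  lucas₃ : ∀ u v e → ((v + u) + e) + ((v + u) + v) ≡ (((v + u) + v) + (v + u)) + e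
  lucas₃ = solve-∀

  u = L (3 + k)
  v = L (4 + k)

  starts : lo (6 + k) ≡ lo (4 + k) + L (5 + k)
  starts = begin
    lo (6 + k)                      ≡⟨ lo≡L+parity (6 + k) ⟩
    L (6 + k) + parity k            ≡⟨ lucas₁ u v (parity k) ⟩
    (L (4 + k) + parity k) + L (5 + k) ≡⟨ cong (_+ L (5 + k)) (sym (lo≡L+parity (4 + k))) ⟩
    lo (4 + k) + L (5 + k)          ∎

  gap₁ : suc (hi (4 + k) + L (5 + k)) ≡ lo (3 + k) + L (6 + k)
  gap₁ = begin
    suc (hi (4 + k)) + L (5 + k)             ≡⟨ cong (_+ L (5 + k)) (suc-hi≡lo-suc (4 + k)) ⟩
    lo (5 + k) + L (5 + k)                   ≡⟨ cong (_+ L (5 + k)) (lo≡L+parity (5 + k)) ⟩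
    (L (5 + k) + parity (1 + k)) + L (5 + k) ≡⟨ lucas₂ u v (parity (1 + k)) ⟩
    (L (3 + k) + parity (1 + k)) + L (6 + k) ≡⟨ cong (_+ L (6 + k)) (sym (lo≡L+parity (3 + k))) ⟩
    lo (3 + k) + L (6 + k)                   ∎

  gap₂ : suc (hi (3 + k) + L (6 + k)) ≡ lo (4 + k) + L (6 + k)
  gap₂ = cong (_+ L (6 + k)) (suc-hi≡lo-suc (3 + k))

  ends : hi (4 + k) + L (6 + k) ≡ hi (6 + k)
  ends = suc-injective (begin
    suc (hi (4 + k)) + L (6 + k)             ≡⟨ cong (_+ L (6 + k)) (suc-hi≡lo-suc (4 + k)) ⟩
    lo (5 + k) + L (6 + k)                   ≡⟨ cong (_+ L (6 + k)) (lo≡L+parity (5 + k)) ⟩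
    (L (5 + k) + parity (1 + k)) + L (6 + k) ≡⟨ lucas₃ u v (parity (1 + k)) ⟩
    L (7 + k) + parity (1 + k)               ≡⟨ sym (lo≡L+parity (7 + k)) ⟩
    lo (7 + k)                               ≡⟨ sym (suc-hi≡lo-suc (6 + k)) ⟩
    suc (hi (6 + k))                         ∎)

split-tiles : ∀ k → Tiles (lo (3 + k)) (hi (3 + k)) (split (3 + k))
split-tiles zero                = inj₁ refl , refl , refl
split-tiles (suc zero)          = inj₂ (inj₁ refl) , refl , refl
split-tiles (suc (suc zero))    = inj₂ (inj₂ refl) , refl , refl
split-tiles (suc (suc (suc k))) = split-step-tiles k (split-tiles (suc k)) (split-tiles k)

Ξ-tiles : ∀ m → Tiles (suc (L (3 + 2 * m))) (L (5 + 2 * m)) (split (3 + 2 * m) ++ split (4 + 2 * m))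
Ξ-tiles m =
  Tiles-resp (split (3 + k) ++ split (4 + k)) starts ends
    (Tiles-++ (split (3 + k)) (split-tiles k)
      (Tiles-resp (split (4 + k)) (sym (suc-hi≡lo-suc (3 + k))) refl (split-tiles (suc k))))
  where
  k = 2 * m

  starts : lo (3 + k) ≡ suc (L (3 + k))
  starts = begin
    lo (3 + k)                 ≡⟨ lo≡L+parity (3 + k) ⟩
    L (3 + k) + parity (1 + k) ≡⟨ cong (L (3 + k) +_) (parity-odd m) ⟩
    L (3 + k) + 1              ≡⟨ +-comm (L (3 + k)) 1 ⟩
    suc (L (3 + k))            ∎

  ends : hi (4 + k) ≡ L (5 + k)
  ends = suc-injective (begin
    suc (hi (4 + k))           ≡⟨ suc-hi≡lo-suc (4 + k) ⟩
    lo (5 + k)                 ≡⟨ lo≡L+parity (5 + k) ⟩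
    L (5 + k) + parity (1 + k) ≡⟨ cong (L (5 + k) +_) (parity-odd m) ⟩
    L (5 + k) + 1              ≡⟨ +-comm (L (5 + k)) 1 ⟩
    suc (L (5 + k))            ∎)

Ξ-tiled : ∀ n → 2 ≤ n → Tiles (loΞ n) (hiΞ n) (splitΞ n)
Ξ-tiled (suc zero) (s≤s ())
Ξ-tiled (suc (suc m)) _ =
  subst (λ j → Tiles (suc (L (j ∸ 1))) (L (suc j)) (split (j ∸ 1) ++ split j))
    (sym (*-distribˡ-+ 2 2 m)) (Ξ-tiles m)

C-++ : ∀ ts us → C (ts ++ us) ≡ C ts ++ C us
C-++ = map-++ proj₁

C-shift : ∀ y ts → C (map (shift y) ts) ≡ C ts
C-shift y ts = sym (map-∘ ts)

C-split-step : ∀ k → C (split (6 + k)) ≡ C (split (4 + k)) ++ C (split (3 + k)) ++ C (split (4 + k))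
C-split-step k = begin
  C (map (shift (L (5 + k))) (split (4 + k)) ++ map (shift (L (6 + k))) (split (3 + k)) ++ _)
    ≡⟨ C-++ (map (shift (L (5 + k))) (split (4 + k))) _ ⟩
  C (map (shift (L (5 + k))) (split (4 + k))) ++ C (map (shift (L (6 + k))) (split (3 + k)) ++ _)
    ≡⟨ cong₂ _++_ (C-shift _ (split (4 + k))) (C-++ (map (shift (L (6 + k))) (split (3 + k))) _) ⟩
  C (split (4 + k)) ++ C (map (shift (L (6 + k))) (split (3 + k))) ++ C (map (shift (L (6 + k))) (split (4 + k)))
    ≡⟨ cong (C (split (4 + k)) ++_) (cong₂ _++_ (C-shift _ (split (3 + k))) (C-shift _ (split (4 + k)))) ⟩
  C (split (4 + k)) ++ C (split (3 + k)) ++ C (split (4 + k)) ∎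

δL-at : ℕ → AB → List ℕ
δL-at k a = C (split (5 + k)) ++ C (split (4 + k))
δL-at k b = C (split (3 + k)) ++ C (split (4 + k))

δ-at : ℕ → List AB → List ℕ
δ-at k = concatMap (δL-at k)

δ≗δ-at-0 : ∀ w → δ w ≡ δ-at 0 w
δ≗δ-at-0 = concatMap-cong λ { a → refl ; b → refl }

δL-at-hL : ∀ k x → δ-at k (hL x) ≡ δL-at (2 + k) x
δL-at-hL k a = begin
  (X ++ Y) ++ (X ++ Y) ++ (Z ++ Y) ++ []  ≡⟨ cong (λ w → (X ++ Y) ++ (X ++ Y) ++ w) (++-identityʳ (Z ++ Y)) ⟩
  (X ++ Y) ++ (X ++ Y) ++ (Z ++ Y)        ≡⟨ ++-assoc X Y _ ⟩
  X ++ Y ++ (X ++ Y) ++ (Z ++ Y)          ≡⟨ cong (λ w → X ++ Y ++ w) (++-assoc X Y _) ⟩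
  X ++ Y ++ X ++ Y ++ Z ++ Y              ≡⟨ cong (X ++_) (sym (++-assoc Y X _)) ⟩
  X ++ (Y ++ X) ++ Y ++ Z ++ Y            ≡⟨ sym (++-assoc X (Y ++ X) _) ⟩
  (X ++ Y ++ X) ++ Y ++ Z ++ Y            ≡⟨ sym (cong₂ _++_ (C-split-step (suc k)) (C-split-step k)) ⟩
  C (split (7 + k)) ++ C (split (6 + k))  ∎
  where
  X = C (split (5 + k))
  Y = C (split (4 + k))
  Z = C (split (3 + k))
δL-at-hL k b = begin
  (X ++ Y) ++ (Z ++ Y) ++ []             ≡⟨ cong ((X ++ Y) ++_) (++-identityʳ (Z ++ Y)) ⟩
  (X ++ Y) ++ Z ++ Y                     ≡⟨ ++-assoc X Y _ ⟩
  X ++ Y ++ Z ++ Y                       ≡⟨ sym (cong (X ++_) (C-split-step k)) ⟩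
  C (split (5 + k)) ++ C (split (6 + k)) ∎
  where
  X = C (split (5 + k))
  Y = C (split (4 + k))
  Z = C (split (3 + k))

δ-at-h : ∀ k w → δ-at k (h w) ≡ δ-at (2 + k) w
δ-at-h k []      = refl
δ-at-h k (x ∷ w) = begin
  δ-at k (hL x ++ h w)           ≡⟨ concatMap-++ (δL-at k) (hL x) (h w) ⟩
  δ-at k (hL x) ++ δ-at k (h w)  ≡⟨ cong₂ _++_ (δL-at-hL k x) (δ-at-h k w) ⟩
  δ-at (2 + k) (x ∷ w)           ∎

δ-at-h^ : ∀ n k w → δ-at k (h^ n w) ≡ δ-at (k + 2 * n) w
δ-at-h^ zero    k w = cong (λ j → δ-at j w) (sym (+-identityʳ k))
δ-at-h^ (suc n) k w = begin
  δ-at k (h (h^ n w))      ≡⟨ δ-at-h k (h^ n w) ⟩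
  δ-at (2 + k) (h^ n w)    ≡⟨ δ-at-h^ n (2 + k) w ⟩
  δ-at (2 + k + 2 * n) w   ≡⟨ cong (λ j → δ-at j w) (level k n) ⟩
  δ-at (k + 2 * suc n) w   ∎
  where
  level : ∀ k n → 2 + k + 2 * n ≡ k + 2 * suc n
  level = solve-∀

CΞ≡δ∘h^ : ∀ n → CΞ (n + 2) ≡ δ (h^ n (b ∷ []))
CΞ≡δ∘h^ n = begin
  CΞ (n + 2)                                         ≡⟨ cong CΞ (+-comm n 2) ⟩
  C (split (2 * (2 + n) ∸ 1) ++ split (2 * (2 + n))) ≡⟨ C-++ (split (2 * (2 + n) ∸ 1)) _ ⟩
  C (split (2 * (2 + n) ∸ 1)) ++ C (split (2 * (2 + n)))
    ≡⟨ cong (λ j → C (split (j ∸ 1)) ++ C (split j)) (*-distribˡ-+ 2 2 n) ⟩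
  δL-at (2 * n) b                                    ≡⟨ sym (++-identityʳ _) ⟩
  δ-at (2 * n) (b ∷ [])                              ≡⟨ sym (δ-at-h^ n 0 (b ∷ [])) ⟩
  δ-at 0 (h^ n (b ∷ []))                             ≡⟨ sym (δ≗δ-at-0 (h^ n (b ∷ []))) ⟩
  δ (h^ n (b ∷ []))                                  ∎

theorem4p2 : ((n : ℕ) → 2 ≤ n → Tiles (loΞ n) (hiΞ n) (splitΞ n))
    × ((n : ℕ) → CΞ (n + 2) ≡ δ (h^ n (b ∷ [])))
theorem4p2 = Ξ-tiled , CΞ≡δ∘h^
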